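{- Let $G_1$ and $G_2$ be finite simple graphs, and let $V_1,\dots,V_k$ be the coloring classes of a FAT $k$-coloring of $G_1$ with parameter $\alpha$. Then the tensor product $G_1\times G_2$ admits a FAT $k$-coloring with parameter $\alpha$, whose coloring classes are the sets $V_i\times V(G_2)$, $i=1,\dots,k$.
   Context: The tensor (Kronecker) product $G_1\times G_2$ has vertex set $V(G_1)\times V(G_2)$, with $(v_i,w_k)\sim(v_j,w_l)$ iff $\{v_i,v_j\}\in E(G_1)$ and $\{w_k,w_l\}\in E(G_2)$. A $k$-coloring with classes $V_1,\dots,V_k$ is FAT with parameter $\alpha\in[0,1]$ if, with $\beta:=1-(k-1)\alpha$, every vertex $v$ satisfies $e(v,V_i)=\alpha\deg v$ for each $V_i\not\ni v$ and $e(v,V_i)=\beta\deg v$ for $V_i\ni v$, where $e(v,S)$ is the number of neighbors of $v$ in $S$. -}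

module Defs where

open import Data.Nat using (ℕ; zero; suc)
open import Data.Bool using (Bool; true; false; _∧_; if_then_else_)
open import Data.Fin using (Fin; remQuot)
open import Data.Fin.Properties using (_≟_)
open import Data.List using (map; allFin)
open import Data.Nat.ListAction using (sum)
open import Data.Product using (_×_; proj₁; proj₂)
open import Data.Integer using (+_)
open import Data.Rational using (ℚ; _/_; _*_; _-_; _≤_; 0ℚ; 1ℚ)
open import Relation.Nullary using (does)
open import Relation.Binary.PropositionalEquality using (_≡_)

record Graph : Set where
  field
    n   : ℕ
    adj : Fin n → Fin n → Bool
    sym : ∀ u v → adj u v ≡ adj v u
    irr : ∀ v → adj v v ≡ false
open Graph public

ℕ→ℚ : ℕ → ℚ
ℕ→ℚ m = + m / 1

deg : (G : Graph) → Fin (n G) → ℕ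
deg G v = sum (map (λ u → if adj G v u then 1 else 0) (allFin (n G)))

Coloring : Graph → ℕ → Set
Coloring G k = Fin (n G) → Fin k

eClass : (G : Graph) {k : ℕ} → Coloring G k → Fin (n G) → Fin k → ℕ
eClass G c v i =
  sum (map (λ u → if adj G v u ∧ does (c u ≟ i) then 1 else 0) (allFin (n G)))

βpar : ℕ → ℚ → ℚ
βpar k α = 1ℚ - (ℕ→ℚ (k Data.Nat.∸ 1) * α)

IsFAT : (G : Graph) (k : ℕ) → Coloring G k → ℚ → Set
IsFAT G k c α =
  (0ℚ ≤ α) × (α ≤ 1ℚ) ×
  (∀ v i → (c v ≡ i → ℕ→ℚ (eClass G c v i) ≡ βpar k α * ℕ→ℚ (deg G v))
         × ((c v ≡ i → Data.Empty.⊥) → ℕ→ℚ (eClass G c v i) ≡ α * ℕ→ℚ (deg G v)))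
  where import Data.Empty

-- tensor (Kronecker) product; vertex set Fin (n₁ * n₂) ≅ Fin n₁ × Fin n₂ via remQuot
-- (x corresponds to the pair (fst G H x , snd G H x); remQuot is a bijection
--  with inverse combine, see Data.Fin.Properties).
fst : (G H : Graph) → Fin (n G Data.Nat.* n H) → Fin (n G)
fst G H x = proj₁ (remQuot {n G} (n H) x)

snd : (G H : Graph) → Fin (n G Data.Nat.* n H) → Fin (n H)
snd G H x = proj₂ (remQuot {n G} (n H) x)

tensor : Graph → Graph → Graph
tensor G H = record
  { n   = n G Data.Nat.* n H
  ; adj = λ x y → adj G (fst G H x) (fst G H y) ∧ adj H (snd G H x) (snd G H y)
  ; sym = λ x y → cong₂ _∧_ (sym G (fst G H x) (fst G H y)) (sym H (snd G H x) (snd G H y))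
  ; irr = λ x → irrLemma (irr G (fst G H x))
  }
  where
  open import Relation.Binary.PropositionalEquality using (cong₂)
  irrLemma : ∀ {a b : Bool} → a ≡ false → (a ∧ b) ≡ false
  irrLemma {false} _ = Relation.Binary.PropositionalEquality.refl

liftColoring : (G H : Graph) {k : ℕ} → Coloring G k → Coloring (tensor G H) k
liftColoring G H c x = c (fst G H x)

-- A neighbour of (a, b) in the tensor product is a pair (u, w) with u ~ a and
-- w ~ b, so the neighbours of (a, b) in V_i × V(G₂) number e(a, V_i) · deg b,
-- while deg (a, b) = deg a · deg b.  Both sides of each FAT identity at a are
-- thus multiplied by deg b, and the identities survive with the same α.
module Submission where

open import Defs hiding (sym)
open import Data.Nat using (ℕ; zero; suc; _+_; _*_)
open import Data.Nat.Properties using (+-assoc; *-identityʳ; *-zeroʳ; +-*-semiring)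
open import Data.Nat.Coprimality using (1-coprimeTo) renaming (sym to coprime-sym)
open import Data.Bool using (true; false; _∧_; if_then_else_)
open import Data.Fin using (Fin; zero; suc; remQuot; combine; _↑ˡ_; _↑ʳ_)
open import Data.Fin.Properties using (_≟_; remQuot-combine)
open import Data.List using (map; allFin; tabulate)
open import Data.Nat.ListAction using () renaming (sum to sumˡ)
open import Data.Product using (_×_; _,_)
import Data.Product as Product
import Data.Integer as ℤ
open import Data.Integer.Properties using (pos-*)
open import Data.Rational using (ℚ; mkℚ; _/_) renaming (_*_ to _*ℚ_)
open import Data.Rational.Properties using (normalize-coprime) renaming (*-assoc to *ℚ-assoc)
open import Algebra.Properties.Semiring.Sum +-*-semiring using (sum; sum-syntax; sum-cong-≗; *-distribˡ-sum; *-distribʳ-sum)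
open import Relation.Nullary using (does)
open import Relation.Binary.PropositionalEquality
open import Function using (_∘_; const)

ℕ→ℚ≡mkℚ : ∀ m → ℕ→ℚ m ≡ mkℚ (ℤ.+ m) 0 (coprime-sym (1-coprimeTo m))
ℕ→ℚ≡mkℚ m = normalize-coprime (coprime-sym (1-coprimeTo m))

ℕ→ℚ-homo-* : ∀ m n → ℕ→ℚ (m * n) ≡ ℕ→ℚ m *ℚ ℕ→ℚ n
ℕ→ℚ-homo-* m n rewrite ℕ→ℚ≡mkℚ m | ℕ→ℚ≡mkℚ n = cong (_/ 1) (pos-* m n)

proportional-*ʳ : ∀ e D d (γ : ℚ) →
  ℕ→ℚ e ≡ γ *ℚ ℕ→ℚ D → ℕ→ℚ (e * d) ≡ γ *ℚ ℕ→ℚ (D * d)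
proportional-*ʳ e D d γ e≡γD = begin
  ℕ→ℚ (e * d)              ≡⟨ ℕ→ℚ-homo-* e d ⟩
  ℕ→ℚ e *ℚ ℕ→ℚ d           ≡⟨ cong (_*ℚ ℕ→ℚ d) e≡γD ⟩
  (γ *ℚ ℕ→ℚ D) *ℚ ℕ→ℚ d    ≡⟨ *ℚ-assoc γ _ _ ⟩
  γ *ℚ (ℕ→ℚ D *ℚ ℕ→ℚ d)    ≡⟨ cong (γ *ℚ_) (sym (ℕ→ℚ-homo-* D d)) ⟩
  γ *ℚ ℕ→ℚ (D * d)         ∎
  where open ≡-Reasoning

sumˡ-map-tabulate : ∀ {A : Set} n (g : Fin n → A) (f : A → ℕ) →
  sumˡ (map f (tabulate g)) ≡ ∑[ i < n ] f (g i)
sumˡ-map-tabulate zero    g f = refl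
sumˡ-map-tabulate (suc n) g f = cong (f (g zero) +_) (sumˡ-map-tabulate n (g ∘ suc) f)

sumˡ-map-allFin : ∀ n (f : Fin n → ℕ) → sumˡ (map f (allFin n)) ≡ ∑[ i < n ] f i
sumˡ-map-allFin n = sumˡ-map-tabulate n (λ i → i)

∑-↑ : ∀ m n (f : Fin (m + n) → ℕ) →
  ∑[ k < m + n ] f k ≡ ∑[ i < m ] f (i ↑ˡ n) + ∑[ j < n ] f (m ↑ʳ j)
∑-↑ zero    n f = refl
∑-↑ (suc m) n f = trans (cong (f zero +_) (∑-↑ m n (f ∘ suc))) (sym (+-assoc (f zero) _ _))

∑-combine : ∀ m n (f : Fin (m * n) → ℕ) →
  ∑[ k < m * n ] f k ≡ ∑[ i < m ] ∑[ j < n ] f (combine i j)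
∑-combine zero    n f = refl
∑-combine (suc m) n f =
  trans (∑-↑ n (m * n) f) (cong (sum (λ j → f (j ↑ˡ (m * n))) +_) (∑-combine m n (f ∘ (n ↑ʳ_))))

∑-*-∑ : ∀ m n (f : Fin m → ℕ) (g : Fin n → ℕ) →
  ∑[ i < m ] ∑[ j < n ] (f i * g j) ≡ (∑[ i < m ] f i) * (∑[ j < n ] g j)
∑-*-∑ m n f g = sym (trans (*-distribʳ-sum (sum g) f) (sum-cong-≗ (λ i → *-distribˡ-sum (f i) g)))

-- deg and e(v, V_i) are the cases w = 1 and w = indicator of V_i.
weightedDegree : (G : Graph) → Fin (n G) → (Fin (n G) → ℕ) → ℕ
weightedDegree G v w = ∑[ u < n G ] (if adj G v u then w u else 0)

deg≡weightedDegree : ∀ G v → deg G v ≡ weightedDegree G v (const 1)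
deg≡weightedDegree G v = sumˡ-map-allFin (n G) _

if-∧-then-1 : ∀ a b → (if a ∧ b then 1 else 0) ≡ (if a then (if b then 1 else 0) else 0)
if-∧-then-1 true  b = refl
if-∧-then-1 false b = refl

eClass≡weightedDegree : ∀ G {k} (c : Coloring G k) v i →
  eClass G c v i ≡ weightedDegree G v (λ u → if does (c u ≟ i) then 1 else 0)
eClass≡weightedDegree G c v i =
  trans (sumˡ-map-allFin (n G) _) (sum-cong-≗ (λ u → if-∧-then-1 (adj G v u) (does (c u ≟ i))))

if-∧-then-* : ∀ a b m → (if a ∧ b then m else 0) ≡ (if a then m else 0) * (if b then 1 else 0)
if-∧-then-* true  true  m = sym (*-identityʳ m)
if-∧-then-* true  false m = sym (*-zeroʳ m)
if-∧-then-* false b     m = refl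

module _ (G H : Graph) where

  weightedDegree-tensor : ∀ x (w : Fin (n G) → ℕ) →
    weightedDegree (tensor G H) x (w ∘ fst G H) ≡ weightedDegree G (fst G H x) w * deg H (snd G H x)
  weightedDegree-tensor x w = begin
    weightedDegree (tensor G H) x (w ∘ fst G H)
      ≡⟨ ∑-combine (n G) (n H) (summand ∘ remQuot′) ⟩
    ∑[ u < n G ] ∑[ v < n H ] summand (remQuot′ (combine u v))
      ≡⟨ sum-cong-≗ (λ u → sum-cong-≗ (λ v → cong summand (remQuot-combine u v))) ⟩
    ∑[ u < n G ] ∑[ v < n H ] summand (u , v)
      ≡⟨ sum-cong-≗ (λ u → sum-cong-≗ (λ v → if-∧-then-* (adj G a u) (adj H b v) (w u))) ⟩
    ∑[ u < n G ] ∑[ v < n H ] ((if adj G a u then w u else 0) * (if adj H b v then 1 else 0))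
      ≡⟨ ∑-*-∑ (n G) (n H) _ _ ⟩
    weightedDegree G a w * weightedDegree H b (const 1)
      ≡⟨ cong (weightedDegree G a w *_) (sym (deg≡weightedDegree H b)) ⟩
    weightedDegree G a w * deg H b ∎
    where
    open ≡-Reasoning
    a = fst G H x
    b = snd G H x
    remQuot′ : Fin (n G * n H) → Fin (n G) × Fin (n H)
    remQuot′ = remQuot (n H)
    summand : Fin (n G) × Fin (n H) → ℕ
    summand (u , v) = if adj G a u ∧ adj H b v then w u else 0

  deg-tensor : ∀ x → deg (tensor G H) x ≡ deg G (fst G H x) * deg H (snd G H x)
  deg-tensor x = begin
    deg (tensor G H) x                                   ≡⟨ deg≡weightedDegree (tensor G H) x ⟩
    weightedDegree (tensor G H) x (const 1 ∘ fst G H)    ≡⟨ weightedDegree-tensor x (const 1) ⟩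
    weightedDegree G (fst G H x) (const 1) * deg H (snd G H x)
      ≡⟨ cong (_* deg H (snd G H x)) (sym (deg≡weightedDegree G (fst G H x))) ⟩
    deg G (fst G H x) * deg H (snd G H x)                ∎
    where open ≡-Reasoning

  eClass-tensor : ∀ {k} (c : Coloring G k) x i →
    eClass (tensor G H) (liftColoring G H c) x i ≡ eClass G c (fst G H x) i * deg H (snd G H x)
  eClass-tensor c x i = begin
    eClass (tensor G H) (liftColoring G H c) x i      ≡⟨ eClass≡weightedDegree (tensor G H) (liftColoring G H c) x i ⟩
    weightedDegree (tensor G H) x (inClass ∘ fst G H) ≡⟨ weightedDegree-tensor x inClass ⟩
    weightedDegree G (fst G H x) inClass * deg H (snd G H x)
      ≡⟨ cong (_* deg H (snd G H x)) (sym (eClass≡weightedDegree G c (fst G H x) i)) ⟩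
    eClass G c (fst G H x) i * deg H (snd G H x)      ∎
    where
    open ≡-Reasoning
    inClass : Fin (n G) → ℕ
    inClass u = if does (c u ≟ i) then 1 else 0

  eClass-proportional-tensor : ∀ {k} (c : Coloring G k) x i (γ : ℚ) →
    ℕ→ℚ (eClass G c (fst G H x) i) ≡ γ *ℚ ℕ→ℚ (deg G (fst G H x)) →
    ℕ→ℚ (eClass (tensor G H) (liftColoring G H c) x i) ≡ γ *ℚ ℕ→ℚ (deg (tensor G H) x)
  eClass-proportional-tensor c x i γ proportional =
    subst₂ (λ e D → ℕ→ℚ e ≡ γ *ℚ ℕ→ℚ D) (sym (eClass-tensor c x i)) (sym (deg-tensor x))
      (proportional-*ʳ (eClass G c (fst G H x) i) (deg G (fst G H x)) (deg H (snd G H x)) γ proportional)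

mainTheorem9 : (G₁ G₂ : Graph) (k : ℕ) (c : Coloring G₁ k) (α : ℚ) →
    IsFAT G₁ k c α → IsFAT (tensor G₁ G₂) k (liftColoring G₁ G₂ c) α
mainTheorem9 G₁ G₂ k c α (0≤α , α≤1 , fat) = 0≤α , α≤1 , λ x i →
  Product.map (eClass-proportional-tensor G₁ G₂ c x i (βpar k α) ∘_)
              (eClass-proportional-tensor G₁ G₂ c x i α ∘_)
              (fat (fst G₁ G₂ x) i)
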